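{- A morphism in $\mathbf{Monogr}$ is a monomorphism if and only if its underlying function on edges is injective.
   Context: A monograph is a set $A$ of ordered pairs which is a functional relation with domain some set $\mathrm{E}_A$ (the edges of $A$) such that each $A(x)$, $x\in\mathrm{E}_A$, is a function $\lambda\to\mathrm{E}_A$ for some ordinal $\lambda=|x|$ (the length of $x$); $x_\iota$ denotes $A(x)(\iota)$. A morphism $f:A\to B$ is a function $f:\mathrm{E}_A\to\mathrm{E}_B$ with $|f(x)|=|x|$ and $f(x_\iota)=f(x)_\iota$ for all $x\in\mathrm{E}_A$, $\iota<|x|$. $\mathbf{Monogr}$ is the category of monographs and morphisms, with composition of functions. -}

module Defs where

open import Level using (0ℓ)
open import Data.Product using (Σ; Σ-syntax; _,_; proj₁)
open import Relation.Binary.Core using (Rel)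
open import Relation.Binary.Structures using (IsStrictTotalOrder)
open import Relation.Binary.PropositionalEquality using (_≡_; subst; sym)
open import Induction.WellFounded using (WellFounded)
open import Function.Definitions using (Injective)

-- A model of the ordinals used as lengths: a well-founded strict total
-- order (i.e. a well-order).  Any von Neumann ordinal (or the class of
-- all ordinals, restricted to a bound) is an instance.
record Ordinals : Set₁ where
  field
    Ord   : Set
    _<_   : Rel Ord 0ℓ
    isSTO : IsStrictTotalOrder _≡_ _<_
    wf    : WellFounded _<_

  Below : Ord → Set
  Below λ′ = Σ[ ι ∈ Ord ] (ι < λ′)

module _ (Ω : Ordinals) where
  open Ordinals Ω

  record Monograph : Set₁ where
    field
      E    : Set
      len  : E → Ord
      edge : (x : E) → Below (len x) → E

  open Monograph

  record Morphism (A B : Monograph) : Set where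
    field
      fun     : E A → E B
      len-pres : (x : E A) → len B (fun x) ≡ len A x
      edge-pres : (x : E A) (ι : Below (len A x)) →
                  fun (edge A x ι) ≡ edge B (fun x) (subst Below (sym (len-pres x)) ι)

  open Morphism

  -- composition of morphisms is composition of the underlying functions;
  -- morphisms are equal iff their underlying functions are equal (pointwise)
  _≈ᴹ_ : {A B : Monograph} → Morphism A B → Morphism A B → Set
  g ≈ᴹ h = ∀ x → fun g x ≡ fun h x

  IsMono : {A B : Monograph} → Morphism A B → Set₁
  IsMono {A} {B} f = (C : Monograph) (g h : Morphism C A) →
    (∀ c → fun f (fun g c) ≡ fun f (fun h c)) → g ≈ᴹ h

  IsInjective : {A B : Monograph} → Morphism A B → Set
  IsInjective f = Injective _≡_ _≡_ (fun f)

{-# OPTIONS --safe #-}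
module Submission where

open import Defs
open import Function.Bundles using (_⇔_; mk⇔)
open import Data.Product using (Σ-syntax; _,_; proj₁; proj₂)
open import Relation.Binary.PropositionalEquality
open import Relation.Binary.PropositionalEquality.Properties using (subst-subst)
open import Axiom.UniquenessOfIdentityProofs.WithK using (uip)

-- Injective morphisms are trivially left-cancellable.  Conversely, a
-- monomorphism f : A → B is cancellable against the two projections of
-- its kernel pair {(x , y) | f x ≡ f y}, which is again a monograph:
-- lengths are equal along a fibre of f, and the ι-th edges of x and y
-- have equal images because f x ≡ f y.  Cancelling gives x ≡ y.

module _ (Ω : Ordinals) where
  open Ordinals Ω
  open Monograph
  open Morphism

  edge-cong : (A : Monograph Ω) {o : Ord} {u v : E A} → u ≡ v →
    (p : o ≡ len A u) (q : o ≡ len A v) (ι : Below o) →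
    edge A u (subst Below p ι) ≡ edge A v (subst Below q ι)
  edge-cong A refl refl refl ι = refl

  module _ {A B : Monograph Ω} (f : Morphism Ω A B) where

    len-fibre : {x y : E A} → fun f x ≡ fun f y → len A x ≡ len A y
    len-fibre {x} {y} fx≡fy = begin
      len A x         ≡⟨ len-pres f x ⟨
      len B (fun f x) ≡⟨ cong (len B) fx≡fy ⟩
      len B (fun f y) ≡⟨ len-pres f y ⟩
      len A y         ∎
      where open ≡-Reasoning

    edge-fibre : {x y : E A} (fx≡fy : fun f x ≡ fun f y) (ι : Below (len A x)) →
      fun f (edge A x ι) ≡ fun f (edge A y (subst Below (len-fibre fx≡fy) ι))
    edge-fibre {x} {y} fx≡fy ι = begin
      fun f (edge A x ι)
        ≡⟨ edge-pres f x ι ⟩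
      edge B (fun f x) (subst Below (sym (len-pres f x)) ι)
        ≡⟨ edge-cong B fx≡fy _ _ ι ⟩
      edge B (fun f y) (subst Below (trans ℓ (sym (len-pres f y))) ι)
        ≡⟨ cong (edge B (fun f y)) (subst-subst ℓ) ⟨
      edge B (fun f y) (subst Below (sym (len-pres f y)) (subst Below ℓ ι))
        ≡⟨ edge-pres f y _ ⟨
      fun f (edge A y (subst Below ℓ ι)) ∎
      where
      open ≡-Reasoning
      ℓ : len A x ≡ len A y
      ℓ = len-fibre fx≡fy

    KernelPair : Set
    KernelPair = Σ[ x ∈ E A ] Σ[ y ∈ E A ] (fun f x ≡ fun f y)

    kernelPair : Monograph Ω
    kernelPair = record
      { E    = KernelPair
      ; len  = λ (x , _ , _) → len A x
      ; edge = λ (x , y , fx≡fy) ι →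
          edge A x ι , edge A y (subst Below (len-fibre fx≡fy) ι) , edge-fibre fx≡fy ι
      }

    π₁ : Morphism Ω kernelPair A
    π₁ = record
      { fun       = proj₁
      ; len-pres  = λ _ → refl
      ; edge-pres = λ _ _ → refl
      }

    π₂ : Morphism Ω kernelPair A
    π₂ = record
      { fun       = λ (_ , y , _) → y
      ; len-pres  = λ (_ , _ , fx≡fy) → sym (len-fibre fx≡fy)
      ; edge-pres = λ (_ , y , fx≡fy) ι →
          cong (λ ℓ → edge A y (subst Below ℓ ι)) (uip _ _)
      }

    mono⇒injective : IsMono Ω f → IsInjective Ω f
    mono⇒injective mono {x} {y} fx≡fy =
      mono kernelPair π₁ π₂ (λ (_ , _ , fx≡fy) → fx≡fy) (x , y , fx≡fy)

    injective⇒mono : IsInjective Ω f → IsMono Ω f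
    injective⇒mono inj _ _ _ f∘g≈f∘h c = inj (f∘g≈f∘h c)

corollary2 : (Ω : Ordinals) {A B : Monograph Ω} (f : Morphism Ω A B) →
    IsMono Ω f ⇔ IsInjective Ω f
corollary2 Ω f = mk⇔ (mono⇒injective Ω f) (injective⇒mono Ω f)
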